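{- Let $\mathcal{H}$ be a set of wffs of type $o$ of $\mathcal{Q}^{\rm u}_{0}$. If $\mathcal{H}$ has a general model, then $\mathcal{H}$ is consistent, i.e., there is no proof of $F_o$ from $\mathcal{H}$.
   Context: SYNTAX. Type symbols: $\imath$, $o$, and $(\alpha\beta)$ for types $\alpha,\beta$ (functions from $\beta$ to $\alpha$). Primitive symbols: $[$, $]$, $\lambda$; denumerably many variables of each type; logical constants $\mathrm{Q}_{o\alpha\alpha}$ (every $\alpha$) and $\iota_{\alpha(o\alpha)}$ ($\alpha\neq o$); nonlogical constants of various types. Wffs: variables and primitive constants of type $\alpha$; $[\mathbf{A}_{\alpha\beta}\mathbf{B}_\beta]$ of type $\alpha$; $[\lambda\mathbf{x}_\beta\mathbf{A}_\alpha]$ of type $\alpha\beta$. $\mathrm{S}^{\mathbf{x}_\alpha}_{\mathbf{A}_\alpha}\mathbf{B}$ is substitution for free occurrences. ABBREVIATIONS. $[\mathbf{A}_\alpha=\mathbf{B}_\alpha]$ is $[\mathrm{Q}_{o\alpha\alpha}\mathbf{A}_\alpha\mathbf{B}_\alpha]$; $T_o$ is $[\mathrm{Q}_{ooo}=\mathrm{Q}_{ooo}]$; $F_o$ is $[[\lambda x_o T_o]=[\lambda x_o x_o]]$; $[\forall\mathbf{x}_\alpha\mathbf{A}_o]$ is $[[\lambda y_\alpha T_o]=[\lambda\mathbf{x}_\alpha\mathbf{A}_o]]$; $[\mathbf{A}_o\wedge\mathbf{B}_o]$ is $[[\lambda x_o\lambda y_o[[\lambda g_{ooo}[g_{ooo}T_oT_o]]=[\lambda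 g_{ooo}[g_{ooo}x_oy_o]]]]\mathbf{A}_o\mathbf{B}_o]$; $[\mathbf{A}_o\supset\mathbf{B}_o]$ is $[[\lambda x_o\lambda y_o[x_o=[x_o\wedge y_o]]]\mathbf{A}_o\mathbf{B}_o]$; $[\sim\mathbf{A}_o]$ is $[\mathrm{Q}_{ooo}F_o\mathbf{A}_o]$; $[\mathbf{A}_o\vee\mathbf{B}_o]$ is $[[\lambda x_o\lambda y_o[\sim[[\sim x_o]\wedge[\sim y_o]]]]\mathbf{A}_o\mathbf{B}_o]$; $[\exists\mathbf{x}_\alpha\mathbf{A}_o]$ is $[\sim[\forall\mathbf{x}_\alpha\sim\mathbf{A}_o]]$; $[\exists_1\mathbf{x}_\alpha\mathbf{A}_o]$ is $[\exists y_\alpha[[\lambda\mathbf{x}_\alpha\mathbf{A}_o]=\mathrm{Q}_{o\alpha\alpha}y_\alpha]]$; $[\mathbf{A}_\alpha\downarrow]$ is $[\exists x_\alpha[x_\alpha=\mathbf{A}_\alpha]]$ ($x_\alpha$ not in $\mathbf{A}_\alpha$); $[\mathbf{A}_\alpha\uparrow]$ is $[\sim[\mathbf{A}_\alpha\downarrow]]$; $[\mathbf{A}_\alpha\simeq\mathbf{B}_\alpha]$ is $[[\mathbf{A}_\alpha\downarrow\vee\mathbf{B}_\alpha\downarrow]\supset[\mathbf{A}_\alpha=\mathbf{B}_\alpha]]$; $[\mathrm{I}\mathbf{x}_\alpha\mathbf{A}_o]$ is $[\iota_{\alpha(o\alpha)}[\lambda\mathbf{x}_\alpha\mathbf{A}_o]]$.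 PROOF SYSTEM. Axiom schemas A1 $[g_{oo}T_o\wedge g_{oo}F_o]=\forall x_o[g_{oo}x_o]$; A2 $[x_\alpha=y_\alpha]\supset[h_{o\alpha}x_\alpha=h_{o\alpha}y_\alpha]$; A3 $[f_{\alpha\beta}=g_{\alpha\beta}]=\forall x_\beta[f_{\alpha\beta}x_\beta\simeq g_{\alpha\beta}x_\beta]$; A4 $\mathbf{A}_\alpha\downarrow\supset[[\lambda\mathbf{x}_\alpha\mathbf{B}_\beta]\mathbf{A}_\alpha\simeq\mathrm{S}^{\mathbf{x}_\alpha}_{\mathbf{A}_\alpha}\mathbf{B}_\beta]$ ($\mathbf{A}_\alpha$ free for $\mathbf{x}_\alpha$ in $\mathbf{B}_\beta$); A5 $\mathbf{x}_\alpha\downarrow$; A6 $\mathbf{c}_\alpha\downarrow$ ($\mathbf{c}_\alpha$ primitive constant); A7 $[\lambda\mathbf{x}_\alpha\mathbf{B}_\beta]\downarrow$; A8 $\mathbf{A}_{o\beta}\mathbf{B}_\beta\downarrow$; A9 $[\mathbf{A}_{o\beta}\uparrow\vee\mathbf{B}_\beta\uparrow]\supset\sim[\mathbf{A}_{o\beta}\mathbf{B}_\beta]$; A10 $[\mathbf{A}_{\alpha\beta}\uparrow\vee\mathbf{B}_\beta\uparrow]\supset[\mathbf{A}_{\alpha\beta}\mathbf{B}_\beta]\uparrow$ ($\alpha\neq o$); A11 $\mathbf{A}_\alpha\downarrow\supset[\mathbf{B}_\alpha\downarrow\supset[[\mathbf{A}_\alpha\simeq\mathbf{B}_\alpha]\simeq[\mathbf{A}_\alpha=\mathbf{B}_\alpha]]]$;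 A12 $\exists_1\mathbf{x}_\alpha\mathbf{A}_o\supset[[\mathrm{I}\mathbf{x}_\alpha\mathbf{A}_o]\downarrow\wedge\mathrm{S}^{\mathbf{x}_\alpha}_{[\mathrm{I}\mathbf{x}_\alpha\mathbf{A}_o]}\mathbf{A}_o]$ ($\alpha\neq o$, with the freeness proviso); A13 $\sim[\exists_1\mathbf{x}_\alpha\mathbf{A}_o]\supset[\mathrm{I}\mathbf{x}_\alpha\mathbf{A}_o]\uparrow$ ($\alpha\neq o$). Rules: R1 from $\mathbf{A}_\alpha\simeq\mathbf{B}_\alpha$ and $\mathbf{C}_o$ infer $\mathbf{C}_o$ with one occurrence of $\mathbf{A}_\alpha$ (not immediately preceded by $\lambda$) replaced by $\mathbf{B}_\alpha$; R2 modus ponens. A proof of $\mathbf{A}_o$ from a set $\mathcal{H}$ of wffs$_o$: a derivation from theorems of $\mathcal{Q}^{\rm u}_{0}$ and members of $\mathcal{H}$ by R2 and by R1, where R1 may not replace inside a well-formed part $\lambda\mathbf{x}_\beta\mathbf{E}_\gamma$ with $\mathbf{x}_\beta$ free in a member of $\mathcal{H}$ and free in the quasi-equation used. SEMANTICS. A frame: nonempty sets $\mathcal{D}_\alpha$, $\mathcal{D}_o=\{\mathrm{T},\mathrm{F}\}$, $\mathcal{D}_{o\beta}$ consisting of total functions $\mathcal{D}_\beta\to\mathcal{D}_o$, $\mathcal{D}_{\alpha\beta}$ ($\alpha\neq o$) consisting of partial or total functions. An interpretation adds $\mathcal{J}$ mapping primitive constants into the domains, $\mathcal{J}(\mathrm{Q}_{o\alpha\alpha})$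 the identity relation, $\mathcal{J}(\iota_{\alpha(o\alpha)})$ the unique member selector (maps characteristic function of $\{x\}$ to $x$, undefined elsewhere). A general model: an interpretation with a partial valuation $\mathcal{V}_\phi$ (for assignments $\phi$) satisfying (a) $\mathcal{V}_\phi(\mathbf{x})=\phi(\mathbf{x})$; (b) $\mathcal{V}_\phi(\mathbf{c})=\mathcal{J}(\mathbf{c})$; (c) $\mathcal{V}_\phi([\mathbf{A}_{\alpha\beta}\mathbf{B}_\beta])$ is function application when everything is defined, otherwise $\mathrm{F}$ if $\alpha=o$ and undefined if $\alpha\neq o$; (d) $\mathcal{V}_\phi([\lambda\mathbf{x}_\beta\mathbf{B}_\alpha])$ is the $f\in\mathcal{D}_{\alpha\beta}$ with $f(d)$ equal to $\mathcal{V}_{(\phi:\mathbf{x}_\beta/d)}(\mathbf{B}_\alpha)$ when defined and undefined otherwise. $\mathcal{M}$ is a general model for $\mathcal{H}$ if every member of $\mathcal{H}$ has value $\mathrm{T}$ under every assignment. -}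

module Defs where

open import Data.Nat using (ℕ; zero; suc; _⊔_; _≟_)
open import Data.Bool using (Bool; true; false)
open import Data.Maybe using (Maybe; just; nothing; maybe′)
open import Data.Product using (Σ; Σ-syntax; _×_; _,_)
open import Data.Sum using (_⊎_)
open import Data.Unit using (⊤)
open import Data.Empty using (⊥)
open import Relation.Nullary using (¬_; Dec; yes; no)
open import Relation.Binary.PropositionalEquality using (_≡_; refl; cong₂)
open import Function.Bundles using (_⇔_)

-- Types.  fn α β  is Church's (αβ): functions from β to α.

data Ty : Set where
  ι  : Ty
  o  : Ty
  fn : Ty → Ty → Ty

fn-inj : ∀ {a b c d} → fn a b ≡ fn c d → (a ≡ c) × (b ≡ d)
fn-inj refl = refl , refl

_≟T_ : (α β : Ty) → Dec (α ≡ β)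
ι ≟T ι = yes refl
ι ≟T o = no λ ()
ι ≟T fn _ _ = no λ ()
o ≟T ι = no λ ()
o ≟T o = yes refl
o ≟T fn _ _ = no λ ()
fn _ _ ≟T ι = no λ ()
fn _ _ ≟T o = no λ ()
fn a b ≟T fn c d with a ≟T c | b ≟T d
... | yes refl | yes refl = yes refl
... | no p | _ = no λ e → p (Data.Product.proj₁ (fn-inj e))
... | _ | no q = no λ e → q (Data.Product.proj₂ (fn-inj e))

data NotO : Ty → Set where
  ι  : NotO ι
  fn : ∀ {α β} → NotO (fn α β)

module Lang (C : Ty → Set) where

  -- variables are pairs (index , type): denumerably many of each type
  data Tm : Ty → Set where
    var  : ℕ → (α : Ty) → Tm α
    con  : ∀ {α} → C α → Tm α
    Q    : (α : Ty) → Tm (fn (fn o α) α)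
    iota : (α : Ty) → NotO α → Tm (fn α (fn o α))
    _·_  : ∀ {α β} → Tm (fn α β) → Tm β → Tm α
    lam  : ∀ {α} → ℕ → (β : Ty) → Tm α → Tm (fn α β)

  infixl 9 _·_

  data OccursFree (x : ℕ) (α : Ty) : ∀ {β} → Tm β → Set where
    here : OccursFree x α (var x α)
    appl : ∀ {γ β} {A : Tm (fn γ β)} {B : Tm β} → OccursFree x α A → OccursFree x α (A · B)
    appr : ∀ {γ β} {A : Tm (fn γ β)} {B : Tm β} → OccursFree x α B → OccursFree x α (A · B)
    lamo : ∀ {γ} {y : ℕ} {β : Ty} {B : Tm γ} → ¬ (y ≡ x × β ≡ α) → OccursFree x α B →
           OccursFree x α (lam y β B)

  sub : ∀ {α β} → ℕ → (α' : Ty) → α' ≡ α → Tm α → Tm β → Tm β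
  sub x α' e A (var y γ) with y ≟ x | γ ≟T α'
  sub x α' refl A (var y γ) | yes _ | yes refl = A
  ... | _ | _ = var y γ
  sub x α' e A (con c) = con c
  sub x α' e A (Q γ) = Q γ
  sub x α' e A (iota γ n) = iota γ n
  sub x α' e A (F · B) = sub x α' e A F · sub x α' e A B
  sub x α' e A (lam y γ B) with y ≟ x | γ ≟T α'
  ... | yes _ | yes _ = lam y γ B
  ... | _ | _ = lam y γ (sub x α' e A B)

  S : ∀ {α β} → ℕ → Tm α → Tm β → Tm β
  S {α} x A B = sub x α refl A B

  FreeFor : ∀ {α β} → Tm α → ℕ → Tm β → Set
  FreeFor A x (var _ _) = ⊤
  FreeFor A x (con _) = ⊤
  FreeFor A x (Q _) = ⊤
  FreeFor A x (iota _ _) = ⊤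
  FreeFor A x (F · B) = FreeFor A x F × FreeFor A x B
  FreeFor {α} A x (lam y γ B) with y ≟ x | γ ≟T α
  ... | yes _ | yes _ = ⊤
  ... | _ | _ = FreeFor A x B × (OccursFree x α B → ¬ OccursFree y γ A)

  maxVar : ∀ {α} → Tm α → ℕ
  maxVar (var y _) = y
  maxVar (con _) = 0
  maxVar (Q _) = 0
  maxVar (iota _ _) = 0
  maxVar (F · B) = maxVar F ⊔ maxVar B
  maxVar (lam y _ B) = y ⊔ maxVar B

  fresh : ∀ {α} → Tm α → ℕ
  fresh A = suc (maxVar A)

  _≐_ : ∀ {α} → Tm α → Tm α → Tm o
  _≐_ {α} A B = Q α · A · B

  To : Tm o
  To = Q o ≐ Q o

  Fo : Tm o
  Fo = lam 0 o To ≐ lam 0 o (var 0 o)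

  All : ℕ → (α : Ty) → Tm o → Tm o
  All x α A = lam 0 α To ≐ lam x α A

  ooo : Ty
  ooo = fn (fn o o) o

  And : Tm o → Tm o → Tm o
  And A B = lam 0 o (lam 1 o
              (lam 2 ooo (var 2 ooo · To · To) ≐ lam 2 ooo (var 2 ooo · var 0 o · var 1 o)))
            · A · B

  Imp : Tm o → Tm o → Tm o
  Imp A B = lam 0 o (lam 1 o (var 0 o ≐ And (var 0 o) (var 1 o))) · A · B

  Not : Tm o → Tm o
  Not A = Q o · Fo · A

  Or : Tm o → Tm o → Tm o
  Or A B = lam 0 o (lam 1 o (Not (And (Not (var 0 o)) (Not (var 1 o))))) · A · B

  Ex : ℕ → (α : Ty) → Tm o → Tm o
  Ex x α A = Not (All x α (Not A))

  Ex1 : ℕ → (α : Ty) → Tm o → Tm o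
  Ex1 x α A = Ex y α (lam x α A ≐ (Q α · var y α))
    where y = fresh (lam x α A)

  Def : ∀ {α} → Tm α → Tm o
  Def {α} A = Ex (fresh A) α (var (fresh A) α ≐ A)

  Undef : ∀ {α} → Tm α → Tm o
  Undef A = Not (Def A)

  _≃_ : ∀ {α} → Tm α → Tm α → Tm o
  A ≃ B = Imp (Or (Def A) (Def B)) (A ≐ B)

  The : ℕ → (α : Ty) → NotO α → Tm o → Tm α
  The x α n A = iota α n · lam x α A

  data Axiom : Tm o → Set where
    A1  : Axiom (And (var 3 (fn o o) · To) (var 3 (fn o o) · Fo)
                  ≐ All 0 o (var 3 (fn o o) · var 0 o))
    A2  : (α : Ty) → Axiom (Imp (var 0 α ≐ var 1 α)
                              ((var 4 (fn o α) · var 0 α) ≐ (var 4 (fn o α) · var 1 α)))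
    A3  : (α β : Ty) → Axiom ((var 2 (fn α β) ≐ var 3 (fn α β))
                          ≐ All 0 β ((var 2 (fn α β) · var 0 β) ≃ (var 3 (fn α β) · var 0 β)))
    A4  : ∀ {α β} (x : ℕ) (A : Tm α) (B : Tm β) → FreeFor A x B →
          Axiom (Imp (Def A) ((lam x α B · A) ≃ S x A B))
    A5  : (x : ℕ) (α : Ty) → Axiom (Def (var x α))
    A6c : ∀ {α} (c : C α) → Axiom (Def (con c))
    A6Q : (α : Ty) → Axiom (Def (Q α))
    A6ι : (α : Ty) (n : NotO α) → Axiom (Def (iota α n))
    A7  : ∀ {α} (x : ℕ) (β : Ty) (B : Tm α) → Axiom (Def (lam x β B))
    A8  : ∀ {β} (A : Tm (fn o β)) (B : Tm β) → Axiom (Def (A · B))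
    A9  : ∀ {β} (A : Tm (fn o β)) (B : Tm β) → Axiom (Imp (Or (Undef A) (Undef B)) (Not (A · B)))
    A10 : ∀ {α β} → NotO α → (A : Tm (fn α β)) (B : Tm β) →
          Axiom (Imp (Or (Undef A) (Undef B)) (Undef (A · B)))
    A11 : ∀ {α} (A B : Tm α) → Axiom (Imp (Def A) (Imp (Def B) ((A ≃ B) ≃ (A ≐ B))))
    A12 : (x : ℕ) (α : Ty) (n : NotO α) (A : Tm o) → FreeFor (The x α n A) x A →
          Axiom (Imp (Ex1 x α A) (And (Def (The x α n A)) (S x (The x α n A) A)))
    A13 : (x : ℕ) (α : Ty) (n : NotO α) (A : Tm o) →
          Axiom (Imp (Not (Ex1 x α A)) (Undef (The x α n A)))

  -- Replacement of one occurrence of A by B in a wff (rule R1).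
  -- ok x β says whether the replacement may take place inside λx_β.
  -- (The binder position of λ is not a subterm, so it is never replaced.)

  data Rep {α} (ok : ℕ → Ty → Set) (A B : Tm α) : ∀ {γ} → Tm γ → Tm γ → Set where
    here : Rep ok A B A B
    appl : ∀ {γ β} {F F' : Tm (fn γ β)} {E : Tm β} → Rep ok A B F F' → Rep ok A B (F · E) (F' · E)
    appr : ∀ {γ β} {F : Tm (fn γ β)} {E E' : Tm β} → Rep ok A B E E' → Rep ok A B (F · E) (F · E')
    lamr : ∀ {γ} {x : ℕ} {β : Ty} {E E' : Tm γ} → ok x β → Rep ok A B E E' →
           Rep ok A B (lam x β E) (lam x β E')

  anywhere : ℕ → Ty → Set
  anywhere _ _ = ⊤

  data Thm : Tm o → Set where
    ax : ∀ {A} → Axiom A → Thm A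
    r1 : ∀ {α} {A B : Tm α} {E E' : Tm o} → Thm (A ≃ B) → Thm E → Rep anywhere A B E E' → Thm E'
    r2 : ∀ {A B} → Thm A → Thm (Imp A B) → Thm B

  data Proves (H : Tm o → Set) : Tm o → Set where
    thm : ∀ {A} → Thm A → Proves H A
    hyp : ∀ {A} → H A → Proves H A
    r1  : ∀ {α} {A B : Tm α} {E E' : Tm o} → Proves H (A ≃ B) → Proves H E →
          Rep (λ x β → ¬ ((Σ[ G ∈ Tm o ] (H G × OccursFree x β G)) × OccursFree x β (A ≃ B))) A B E E' →
          Proves H E'
    r2  : ∀ {A B} → Proves H A → Proves H (Imp A B) → Proves H B

  record Carriers : Set₁ where
    field
      Dι  : Set
      Dfn : Ty → Ty → Set     -- D_{αβ}, abstract; elements act as functions via the frame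

  module _ (K : Carriers) where
    open Carriers K

    Dom : Ty → Set
    Dom ι = Dι
    Dom o = Bool
    Dom (fn α β) = Dfn α β

    -- possible values of a wff of type α: always defined at type o,
    -- possibly undefined otherwise
    Res : Ty → Set
    Res o = Bool
    Res ι = Maybe Dι
    Res (fn α β) = Maybe (Dfn α β)

    inj : (α : Ty) → Dom α → Res α
    inj ι d = just d
    inj o d = d
    inj (fn _ _) d = just d

    defd : (α : Ty) → Res α → Maybe (Dom α)
    defd ι r = r
    defd o r = just r
    defd (fn _ _) r = r

    undef : (α : Ty) → Res α
    undef ι = nothing
    undef o = false
    undef (fn _ _) = nothing

  -- A frame: D_ι nonempty, D_o = {T,F}, D_{oβ} a set of total functions
  -- D_β → D_o, D_{αβ} (α ≠ o) a set of partial functions D_β ⇀ D_α.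
  -- Elements of D_{αβ} are represented abstractly, acting through an
  -- extensional (hence injective) application map.
  record Frame : Set₁ where
    field
      K    : Carriers
    open Carriers K
    field
      ιne  : Dι
      fnne : (α β : Ty) → Dfn α β
      appo : (β : Ty) → Dfn o β → Dom K β → Bool
      appp : (α β : Ty) → NotO α → Dfn α β → Dom K β → Maybe (Dom K α)
      exto : (β : Ty) (f g : Dfn o β) → (∀ d → appo β f d ≡ appo β g d) → f ≡ g
      extp : (α β : Ty) (n : NotO α) (f g : Dfn α β) →
             (∀ d → appp α β n f d ≡ appp α β n g d) → f ≡ g

    applyD : (α β : Ty) → Dfn α β → Dom K β → Res K α
    applyD ι β f d = appp ι β ι f d
    applyD o β f d = appo β f d
    applyD (fn α γ) β f d = appp (fn α γ) β fn f d

    apR : (α β : Ty) → Res K (fn α β) → Res K β → Res K α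
    apR α β mf r = maybe′ (λ f → maybe′ (applyD α β f) (undef K α) (defd K β r)) (undef K α) mf

  record Interpretation : Set₁ where
    field
      frame : Frame
    open Frame frame public
    open Carriers K public
    field
      J   : ∀ {α} → C α → Dom K α
      JQ  : (α : Ty) → Dfn (fn o α) α
      Jι  : (α : Ty) (n : NotO α) → Dfn α (fn o α)
      JQ-id : (α : Ty) (a : Dom K α) →
              Σ[ g ∈ Dfn o α ] ((appp (fn o α) α fn (JQ α) a ≡ just g) ×
                               ((b : Dom K α) → (appo α g b ≡ true) ⇔ (a ≡ b)))
      Jι-sel : (α : Ty) (n : NotO α) (p : Dfn o α) (x : Dom K α) →
               (appp α (fn o α) n (Jι α n) p ≡ just x) ⇔
               ((y : Dom K α) → (appo α p y ≡ true) ⇔ (y ≡ x))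

  module _ (Ip : Interpretation) where
    open Interpretation Ip

    Asg : Set
    Asg = (x : ℕ) (α : Ty) → Dom K α

    upd : Asg → (x : ℕ) (β : Ty) → Dom K β → Asg
    upd φ x β d y α with y ≟ x | α ≟T β
    ... | yes _ | yes refl = d
    ... | _ | _ = φ y α

  record GeneralModel : Set₁ where
    field
      I : Interpretation
    open Interpretation I public
    field
      V    : Asg I → ∀ {α} → Tm α → Res K α
      Vvar : ∀ φ (x : ℕ) (α : Ty) → V φ (var x α) ≡ inj K α (φ x α)
      Vcon : ∀ φ {α} (c : C α) → V φ (con c) ≡ inj K α (J c)
      VQ   : ∀ φ (α : Ty) → V φ (Q α) ≡ just (JQ α)
      Vι   : ∀ φ (α : Ty) (n : NotO α) → V φ (iota α n) ≡ just (Jι α n)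
      Vapp : ∀ φ {α β} (A : Tm (fn α β)) (B : Tm β) → V φ (A · B) ≡ apR α β (V φ A) (V φ B)
      Vlam : ∀ φ {α} (x : ℕ) (β : Ty) (B : Tm α) →
             Σ[ f ∈ Dfn α β ] ((V φ (lam x β B) ≡ just f) ×
                               ((d : Dom K β) → applyD α β f d ≡ V (upd I φ x β d) B))

  ModelFor : GeneralModel → (Tm o → Set) → Set
  ModelFor M H = ∀ A → H A → ∀ φ → GeneralModel.V M φ A ≡ true

  HasGeneralModel : (Tm o → Set) → Set₁
  HasGeneralModel H = Σ[ M ∈ GeneralModel ] ModelFor M H

  Consistent : (Tm o → Set) → Set
  Consistent H = ¬ Proves H Fo

module Submission where

-- Fix a general model M of H.  Call a wff_o valid when it is true (has value
-- T) under every assignment.  We show that every axiom is valid, that R1 and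
-- R2 preserve validity, and hence (since members of H are valid by
-- assumption) that everything provable from H is valid.  But F_o is false
-- under every assignment, so it is not provable.
--
-- The work lies in computing the values of the abbreviations.  The substitution lemma gives A4, the replacement lemma
-- gives R1, and a characterisation of descriptions gives A12 and A13.

open import Defs
open import Data.Nat using (ℕ; suc; _≟_; _≤_)
open import Data.Nat.Properties using (m≤m⊔n; m≤n⊔m; ≤-trans; ≤-refl; 1+n≰n)
open import Data.Bool using (Bool; true; false; _∧_; not)
open import Data.Maybe using (just; nothing)
open import Data.Product using (Σ-syntax; _×_; _,_; proj₁; proj₂)
open import Data.Sum using (_⊎_; inj₁; inj₂; [_,_]′)
open import Data.Empty using (⊥-elim)
open import Relation.Nullary using (¬_; Dec; yes; no)
open import Relation.Binary.PropositionalEquality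
  using (_≡_; _≢_; refl; sym; trans; cong; cong₂; subst; subst₂; module ≡-Reasoning)
open import Function.Bundles using (_⇔_; mk⇔; Equivalence)
open Equivalence using (to; from)

false≢true : false ≢ true
false≢true ()

bool-ext : ∀ {x y : Bool} → (x ≡ true → y ≡ true) → (y ≡ true → x ≡ true) → x ≡ y
bool-ext {true}  {true}  _ _ = refl
bool-ext {true}  {false} f _ = sym (f refl)
bool-ext {false} {true}  _ g = g refl
bool-ext {false} {false} _ _ = refl

true-stable : ∀ {b} → ¬ ¬ (b ≡ true) → b ≡ true
true-stable {true}  _ = refl
true-stable {false} k = ⊥-elim (k λ ())

-- Boolean equivalence: the value of Q_{ooo} on two truth values.
_⇔ᵇ_ : Bool → Bool → Bool
true  ⇔ᵇ y = y
false ⇔ᵇ y = not y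

⇔ᵇ-true : ∀ x y → (x ⇔ᵇ y ≡ true) ⇔ (x ≡ y)
⇔ᵇ-true true  true  = mk⇔ (λ _ → refl) (λ _ → refl)
⇔ᵇ-true true  false = mk⇔ (λ ()) (λ ())
⇔ᵇ-true false true  = mk⇔ (λ ()) (λ ())
⇔ᵇ-true false false = mk⇔ (λ _ → refl) (λ _ → refl)

not-true : ∀ x → (not x ≡ true) ⇔ (¬ x ≡ true)
not-true true  = mk⇔ (λ ()) (λ h → ⊥-elim (h refl))
not-true false = mk⇔ (λ _ ()) (λ _ → refl)

∧-true : ∀ x y → (x ∧ y ≡ true) ⇔ (x ≡ true × y ≡ true)
∧-true true  true  = mk⇔ (λ _ → refl , refl) (λ _ → refl)
∧-true true  false = mk⇔ (λ ()) (λ ())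
∧-true false y     = mk⇔ (λ ()) (λ ())

-- Implication is defined in Q^u_0 as  x = (x ∧ y).
⊃-true : ∀ x y → (x ⇔ᵇ (x ∧ y) ≡ true) ⇔ (x ≡ true → y ≡ true)
⊃-true true  true  = mk⇔ (λ _ _ → refl) (λ _ → refl)
⊃-true true  false = mk⇔ (λ ()) (λ h → h refl)
⊃-true false y     = mk⇔ (λ _ ()) (λ _ → refl)

-- Disjunction is defined in Q^u_0 as  ¬(¬x ∧ ¬y).
∨-true : ∀ x y → (not (not x ∧ not y) ≡ true) ⇔ (x ≡ true ⊎ y ≡ true)
∨-true true  y     = mk⇔ (λ _ → inj₁ refl) (λ _ → refl)
∨-true false true  = mk⇔ (λ _ → inj₂ refl) (λ _ → refl)
∨-true false false = mk⇔ (λ ()) [ (λ ()) , (λ ()) ]′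

truth-via : ∀ {r b : Bool} {P : Set} → r ≡ b → (b ≡ true) ⇔ P → (r ≡ true) ⇔ P
truth-via refl e = e

module Soundness (C : Ty → Set) (M : Lang.GeneralModel C) where
  open Lang C
  open GeneralModel M

  D : Ty → Set
  D = Dom K

  R : Ty → Set
  R = Res K

  up : Asg I → ℕ → (β : Ty) → D β → Asg I
  up = upd I

  infix 4 _⊨_
  _⊨_ : Asg I → Tm o → Set
  φ ⊨ A = V φ A ≡ true

  data View (α : Ty) : R α → Set where
    defined   : (a : D α) → View α (inj K α a)
    undefined : NotO α → View α (undef K α)

  view : ∀ α (r : R α) → View α r
  view ι (just a) = defined a
  view ι nothing = undefined ι
  view o b = defined b
  view (fn α β) (just f) = defined f
  view (fn α β) nothing = undefined fn

  Defined : ∀ α → R α → Set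
  Defined α r = Σ[ a ∈ D α ] (r ≡ inj K α a)

  -- Both values are defined and equal: the meaning of a true equation.
  DefinedEqual : ∀ α → R α → R α → Set
  DefinedEqual α r s = Σ[ a ∈ D α ] ((r ≡ inj K α a) × (s ≡ inj K α a))

  inj-injective : ∀ α {a b} → inj K α a ≡ inj K α b → a ≡ b
  inj-injective ι refl = refl
  inj-injective o refl = refl
  inj-injective (fn _ _) refl = refl

  undef≢inj : ∀ {α} → NotO α → ∀ {a} → undef K α ≢ inj K α a
  undef≢inj ι ()
  undef≢inj fn ()

  DefinedEqual⇒≡ : ∀ {α r s} → DefinedEqual α r s → r ≡ s
  DefinedEqual⇒≡ (_ , er , es) = trans er (sym es)

  DefinedEqual-inj : ∀ α {r s a b} → DefinedEqual α r s → r ≡ inj K α a → s ≡ inj K α b → a ≡ b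
  DefinedEqual-inj α (_ , er , es) ea eb =
    trans (inj-injective α (trans (sym ea) er)) (sym (inj-injective α (trans (sym eb) es)))

  Defined-stable : ∀ α (r : R α) → ¬ ¬ Defined α r → Defined α r
  Defined-stable α r k with view α r
  ... | defined a = a , refl
  ... | undefined n = ⊥-elim (k λ d → undef≢inj n (proj₂ d))

  -- Two possible values coincide if they are equal whenever one is defined;
  -- this is what the truth of a quasi-equation A ≃ B expresses.
  quasi⇒≡ : ∀ α (r s : R α) → ((Defined α r ⊎ Defined α s) → DefinedEqual α r s) → r ≡ s
  quasi⇒≡ α r s h with view α r | view α s
  ... | defined a   | _         = DefinedEqual⇒≡ (h (inj₁ (a , refl)))
  ... | undefined _ | defined b = DefinedEqual⇒≡ (h (inj₂ (b , refl)))
  ... | undefined _ | undefined _ = refl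

  apply-defined : ∀ α β f b → apR α β (just f) (inj K β b) ≡ applyD α β f b
  apply-defined α ι f b = refl
  apply-defined α o f b = refl
  apply-defined α (fn _ _) f b = refl

  apply-undefined : ∀ α β f → NotO β → apR α β (just f) (undef K β) ≡ undef K α
  apply-undefined α .ι f ι = refl
  apply-undefined α .(fn _ _) f fn = refl

  extensionality : ∀ α β (f g : Dfn α β) → (∀ d → applyD α β f d ≡ applyD α β g d) → f ≡ g
  extensionality ι β = extp ι β ι
  extensionality o β = exto β
  extensionality (fn α γ) β = extp (fn α γ) β fn

  ≟var : ∀ (z : ℕ) (δ : Ty) x α → Dec (z ≡ x × δ ≡ α)
  ≟var z δ x α with z ≟ x | δ ≟T α
  ... | yes p | yes q = yes (p , q)
  ... | no p  | _     = no λ e → p (proj₁ e)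
  ... | yes _ | no q  = no λ e → q (proj₂ e)

  ≢var-sym : ∀ {z x : ℕ} {δ α : Ty} → ¬ (z ≡ x × δ ≡ α) → ¬ (x ≡ z × α ≡ δ)
  ≢var-sym ne e = ne (sym (proj₁ e) , sym (proj₂ e))

  upd-same : ∀ (φ : Asg I) x β d → up φ x β d x β ≡ d
  upd-same φ x β d with x ≟ x | β ≟T β
  ... | yes _ | yes refl = refl
  ... | no p  | _        = ⊥-elim (p refl)
  ... | yes _ | no q     = ⊥-elim (q refl)

  upd-other : ∀ (φ : Asg I) x β d y γ → ¬ (y ≡ x × γ ≡ β) → up φ x β d y γ ≡ φ y γ
  upd-other φ x β d y γ ne with y ≟ x | γ ≟T β
  ... | yes p | yes refl = ⊥-elim (ne (p , refl))
  ... | yes _ | no _ = refl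
  ... | no _  | yes _ = refl
  ... | no _  | no _ = refl

  upd-comm : ∀ φ x α a y γ d → ¬ (y ≡ x × γ ≡ α) → ∀ z δ →
             up (up φ y γ d) x α a z δ ≡ up (up φ x α a) y γ d z δ
  upd-comm φ x α a y γ d ne z δ with ≟var z δ x α
  ... | yes (refl , refl) = trans (upd-same _ z δ a)
        (sym (trans (upd-other _ y γ d z δ (≢var-sym ne)) (upd-same φ z δ a)))
  ... | no z≠x with ≟var z δ y γ
  ...   | yes (refl , refl) = trans (upd-other _ x α a z δ z≠x) (trans (upd-same φ z δ d) (sym (upd-same _ z δ d)))
  ...   | no z≠y = trans (upd-other _ x α a z δ z≠x) (trans (upd-other φ y γ d z δ z≠y)
                    (sym (trans (upd-other _ y γ d z δ z≠y) (upd-other φ x α a z δ z≠x))))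

  lam-cong : ∀ {α} φ ψ x y β (B B' : Tm α) →
             (∀ d → V (up φ x β d) B ≡ V (up ψ y β d) B') → V φ (lam x β B) ≡ V ψ (lam y β B')
  lam-cong {α} φ ψ x y β B B' h with Vlam φ x β B | Vlam ψ y β B'
  ... | f , ef , hf | g , eg , hg =
    trans ef (trans (cong just (extensionality α β f g λ d → trans (hf d) (trans (h d) (sym (hg d))))) (sym eg))

  β-value : ∀ φ {α β} x (B : Tm α) (A : Tm β) b → V φ A ≡ inj K β b →
            V φ (lam x β B · A) ≡ V (up φ x β b) B
  β-value φ {α} {β} x B A b e with Vlam φ x β B
  ... | f , ef , hf = begin
      V φ (lam x β B · A)                ≡⟨ Vapp φ (lam x β B) A ⟩
      apR α β (V φ (lam x β B)) (V φ A)  ≡⟨ cong₂ (apR α β) ef e ⟩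
      apR α β (just f) (inj K β b)       ≡⟨ apply-defined α β f b ⟩
      applyD α β f b                     ≡⟨ hf b ⟩
      V (up φ x β b) B                   ∎
    where open ≡-Reasoning

  β₂-value : ∀ φ {α β γ} x y (B : Tm α) (A : Tm β) (A' : Tm γ) a a' →
             V φ A ≡ inj K β a → V φ A' ≡ inj K γ a' →
             V φ (lam x β (lam y γ B) · A · A') ≡ V (up (up φ x β a) y γ a') B
  β₂-value φ {α} {β} {γ} x y B A A' a a' e e' with Vlam (up φ x β a) y γ B
  ... | f , ef , hf = trans (Vapp φ (lam x β (lam y γ B) · A) A')
        (trans (cong₂ (apR α γ) (trans (β-value φ x (lam y γ B) A a e) ef) e')
               (trans (apply-defined α γ f a') (hf a')))

  Agree : ∀ {α} → Asg I → Asg I → Tm α → Set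
  Agree φ ψ A = ∀ y γ → OccursFree y γ A → φ y γ ≡ ψ y γ

  coincidence : ∀ {α} (A : Tm α) φ ψ → Agree φ ψ A → V φ A ≡ V ψ A
  coincidence (var x α) φ ψ ag = trans (Vvar φ x α) (trans (cong (inj K α) (ag x α here)) (sym (Vvar ψ x α)))
  coincidence (con c) φ ψ _ = trans (Vcon φ c) (sym (Vcon ψ c))
  coincidence (Q α) φ ψ _ = trans (VQ φ α) (sym (VQ ψ α))
  coincidence (iota α n) φ ψ _ = trans (Vι φ α n) (sym (Vι ψ α n))
  coincidence (F · B) φ ψ ag = trans (Vapp φ F B) (trans (cong₂ (apR _ _)
    (coincidence F φ ψ (λ y γ oc → ag y γ (appl oc))) (coincidence B φ ψ (λ y γ oc → ag y γ (appr oc))))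
    (sym (Vapp ψ F B)))
  coincidence (lam x β B) φ ψ ag = lam-cong φ ψ x x β B B λ d → coincidence B _ _ (agree-under d)
    where
    agree-under : ∀ d → Agree (up φ x β d) (up ψ x β d) B
    agree-under d y γ oc with ≟var y γ x β
    ... | yes (refl , refl) = trans (upd-same φ y γ d) (sym (upd-same ψ y γ d))
    ... | no y≠x = trans (upd-other φ x β d y γ y≠x)
                   (trans (ag y γ (lamo (≢var-sym y≠x) oc)) (sym (upd-other ψ x β d y γ y≠x)))

  eqValue : ∀ α → R α → R α → Bool
  eqValue α r s = apR o α (apR (fn o α) α (just (JQ α)) r) s

  V-≐ : ∀ φ {α} (A B : Tm α) → V φ (A ≐ B) ≡ eqValue α (V φ A) (V φ B)
  V-≐ φ {α} A B = trans (Vapp φ (Q α · A) B) (cong (λ m → apR o α m (V φ B))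
                    (trans (Vapp φ (Q α) A) (cong (λ m → apR (fn o α) α m (V φ A)) (VQ φ α))))

  eqValue-undefined : ∀ {α} → NotO α → (s : R α) → eqValue α (undef K α) s ≡ false
  eqValue-undefined {α} n s = cong (λ m → apR o α m s) (apply-undefined (fn o α) α (JQ α) n)

  eqValue-defined : ∀ α a (s : R α) →
    Σ[ g ∈ Dfn o α ] ((eqValue α (inj K α a) s ≡ apR o α (just g) s) ×
                      ((b : D α) → (appo α g b ≡ true) ⇔ (a ≡ b)))
  eqValue-defined α a s with JQ-id α a
  ... | g , e , iff = g , cong (λ m → apR o α m s) (trans (apply-defined (fn o α) α (JQ α) a) e) , iff

  eqValue-true : ∀ α (r s : R α) → (eqValue α r s ≡ true) ⇔ DefinedEqual α r s
  eqValue-true α r s with view α r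
  ... | undefined n =
        mk⇔ (λ h → ⊥-elim (false≢true (trans (sym (eqValue-undefined n s)) h)))
            (λ e → ⊥-elim (undef≢inj n (proj₁ (proj₂ e))))
  ... | defined a with eqValue-defined α a s
  ...   | g , eg , ig with view α s
  ...     | undefined n =
            mk⇔ (λ h → ⊥-elim (false≢true (trans (sym (trans eg (apply-undefined o α g n))) h)))
                (λ e → ⊥-elim (undef≢inj n (proj₂ (proj₂ e))))
  ...     | defined b = mk⇔ forth back
    where
    forth : eqValue α (inj K α a) (inj K α b) ≡ true → DefinedEqual α (inj K α a) (inj K α b)
    forth h = a , refl , cong (inj K α) (sym (to (ig b) (trans (sym (trans eg (apply-defined o α g b))) h)))
    back : DefinedEqual α (inj K α a) (inj K α b) → eqValue α (inj K α a) (inj K α b) ≡ true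
    back e = trans eg (trans (apply-defined o α g b) (from (ig b) (DefinedEqual-inj α e refl refl)))

  ⊨-≐ : ∀ φ {α} (A B : Tm α) → (φ ⊨ A ≐ B) ⇔ DefinedEqual α (V φ A) (V φ B)
  ⊨-≐ φ {α} A B = truth-via (V-≐ φ A B) (eqValue-true α _ _)

  V-≐ₒ : ∀ φ (A B : Tm o) → V φ (A ≐ B) ≡ V φ A ⇔ᵇ V φ B
  V-≐ₒ φ A B = bool-ext
    (λ h → from (⇔ᵇ-true _ _) (DefinedEqual⇒≡ (to (⊨-≐ φ A B) h)))
    (λ h → from (⊨-≐ φ A B) (V φ A , refl , sym (to (⇔ᵇ-true _ _) h)))

  ⊨-≐ₒ : ∀ φ (A B : Tm o) → (φ ⊨ A ≐ B) ⇔ (V φ A ≡ V φ B)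
  ⊨-≐ₒ φ A B = truth-via (V-≐ₒ φ A B) (⇔ᵇ-true _ _)

  V-To : ∀ φ → V φ To ≡ true
  V-To φ = from (⊨-≐ φ (Q o) (Q o)) (JQ o , VQ φ o , VQ φ o)

  V-Fo : ∀ φ → V φ Fo ≡ false
  V-Fo φ = bool-ext (λ h → ⊥-elim (Fo-untrue h)) (λ ())
    where
    open ≡-Reasoning
    -- F_o asserts that λx.T equals λx.x, which fails at the argument F.
    Fo-untrue : ¬ (φ ⊨ Fo)
    Fo-untrue h with Vlam φ 0 o To | Vlam φ 0 o (var 0 o)
    ... | f , ef , hf | g , eg , hg = false≢true (begin
          false                        ≡⟨ sym (trans (hg false) (Vvar _ 0 o)) ⟩
          appo o g false               ≡⟨ cong (λ k → appo o k false) (sym f≡g) ⟩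
          appo o f false               ≡⟨ hf false ⟩
          V (up φ 0 o false) To        ≡⟨ V-To _ ⟩
          true                         ∎)
      where
      f≡g : f ≡ g
      f≡g = DefinedEqual-inj (fn o o) (to (⊨-≐ φ _ _) h) ef eg

  -- Conjunction.  [A ∧ B] is λx λy [λg. g T T] = [λg. g x y] applied to A, B;
  -- it works because D_{ooo} contains the two projections.

  apply₂ : Dfn (fn o o) o → Bool → Bool → Bool
  apply₂ g x y = apR o o (apR (fn o o) o (just g) x) y

  V-apply₂ : ∀ χ (F : Tm ooo) (A B : Tm o) g → V χ F ≡ just g →
             V χ (F · A · B) ≡ apply₂ g (V χ A) (V χ B)
  V-apply₂ χ F A B g e = trans (Vapp χ (F · A) B) (cong (λ m → apR o o m (V χ B))
    (trans (Vapp χ F A) (cong (λ m → apR (fn o o) o m (V χ A)) e)))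

  first-projection : Asg I → Σ[ g ∈ Dfn (fn o o) o ] (∀ x y → apply₂ g x y ≡ x)
  first-projection φ with Vlam φ 3 o (lam 4 o (var 3 o))
  ... | g , eg , hg = g , proj
    where
    proj : ∀ x y → apply₂ g x y ≡ x
    proj x y with Vlam (up φ 3 o x) 4 o (var 3 o)
    ... | h , eh , hh = trans (cong (λ m → apR o o m y) (trans (hg x) eh)) (trans (hh y) (Vvar _ 3 o))

  second-projection : Asg I → Σ[ g ∈ Dfn (fn o o) o ] (∀ x y → apply₂ g x y ≡ y)
  second-projection φ with Vlam φ 3 o (lam 4 o (var 4 o))
  ... | g , eg , hg = g , proj
    where
    proj : ∀ x y → apply₂ g x y ≡ y
    proj x y with Vlam (up φ 3 o x) 4 o (var 4 o)
    ... | h , eh , hh = trans (cong (λ m → apR o o m y) (trans (hg x) eh)) (trans (hh y) (Vvar _ 4 o))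

  AndBody : Tm o
  AndBody = lam 2 ooo (var 2 ooo · To · To) ≐ lam 2 ooo (var 2 ooo · var 0 o · var 1 o)

  ⊨-AndBody : ∀ ψ → (ψ ⊨ AndBody) ⇔ (ψ 0 o ≡ true × ψ 1 o ≡ true)
  ⊨-AndBody ψ with Vlam ψ 2 ooo (var 2 ooo · To · To) | Vlam ψ 2 ooo (var 2 ooo · var 0 o · var 1 o)
  ... | f₁ , e₁ , h₁ | f₂ , e₂ , h₂ = mk⇔ forth back
    where
    at-f₁ : ∀ g → appo ooo f₁ g ≡ apply₂ g true true
    at-f₁ g = trans (h₁ g) (trans (V-apply₂ _ (var 2 ooo) To To g (Vvar _ 2 ooo))
                (cong₂ (apply₂ g) (V-To _) (V-To _)))
    at-f₂ : ∀ g → appo ooo f₂ g ≡ apply₂ g (ψ 0 o) (ψ 1 o)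
    at-f₂ g = trans (h₂ g) (trans (V-apply₂ _ (var 2 ooo) (var 0 o) (var 1 o) g (Vvar _ 2 ooo))
                (cong₂ (apply₂ g) (Vvar _ 0 o) (Vvar _ 1 o)))
    forth : ψ ⊨ AndBody → ψ 0 o ≡ true × ψ 1 o ≡ true
    forth h with first-projection ψ | second-projection ψ
    ... | g₁ , π₁ | g₂ , π₂ = trans (sym (π₁ _ _)) (trans (sym (same g₁)) (π₁ _ _)) ,
                              trans (sym (π₂ _ _)) (trans (sym (same g₂)) (π₂ _ _))
      where
      f₁≡f₂ : f₁ ≡ f₂
      f₁≡f₂ = DefinedEqual-inj (fn o ooo) (to (⊨-≐ ψ _ _) h) e₁ e₂
      same : ∀ g → apply₂ g true true ≡ apply₂ g (ψ 0 o) (ψ 1 o)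
      same g = trans (sym (at-f₁ g)) (trans (cong (λ k → appo ooo k g) f₁≡f₂) (at-f₂ g))
    back : ψ 0 o ≡ true × ψ 1 o ≡ true → ψ ⊨ AndBody
    back (p , q) = from (⊨-≐ ψ _ _) (f₁ , e₁ , trans e₂ (cong just (sym (exto ooo f₁ f₂ λ g →
      trans (at-f₁ g) (trans (cong₂ (apply₂ g) (sym p) (sym q)) (sym (at-f₂ g)))))))

  V-And : ∀ φ A B → V φ (And A B) ≡ V φ A ∧ V φ B
  V-And φ A B = trans (β₂-value φ 0 1 AndBody A B (V φ A) (V φ B) refl refl) (bool-ext
    (λ h → from (∧-true _ _) (to (⊨-AndBody _) h))
    (λ h → from (⊨-AndBody _) (to (∧-true _ _) h)))

  V-Not : ∀ φ A → V φ (Not A) ≡ not (V φ A)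
  V-Not φ A = trans (V-≐ₒ φ Fo A) (cong (_⇔ᵇ V φ A) (V-Fo φ))

  V-Imp : ∀ φ A B → V φ (Imp A B) ≡ V φ A ⇔ᵇ (V φ A ∧ V φ B)
  V-Imp φ A B = trans (β₂-value φ 0 1 _ A B (V φ A) (V φ B) refl refl)
    (trans (V-≐ₒ _ (var 0 o) (And (var 0 o) (var 1 o)))
      (cong₂ _⇔ᵇ_ (Vvar _ 0 o) (trans (V-And _ _ _) (cong₂ _∧_ (Vvar _ 0 o) (Vvar _ 1 o)))))

  V-Or : ∀ φ A B → V φ (Or A B) ≡ not (not (V φ A) ∧ not (V φ B))
  V-Or φ A B = trans (β₂-value φ 0 1 _ A B (V φ A) (V φ B) refl refl)
    (trans (V-Not _ _) (cong not (trans (V-And _ _ _)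
      (cong₂ _∧_ (trans (V-Not _ _) (cong not (Vvar _ 0 o))) (trans (V-Not _ _) (cong not (Vvar _ 1 o)))))))

  ⊨-Not : ∀ φ A → (φ ⊨ Not A) ⇔ (¬ φ ⊨ A)
  ⊨-Not φ A = truth-via (V-Not φ A) (not-true _)

  ⊨-And : ∀ φ A B → (φ ⊨ And A B) ⇔ (φ ⊨ A × φ ⊨ B)
  ⊨-And φ A B = truth-via (V-And φ A B) (∧-true _ _)

  ⊨-Imp : ∀ φ A B → (φ ⊨ Imp A B) ⇔ (φ ⊨ A → φ ⊨ B)
  ⊨-Imp φ A B = truth-via (V-Imp φ A B) (⊃-true _ _)

  ⊨-Or : ∀ φ A B → (φ ⊨ Or A B) ⇔ (φ ⊨ A ⊎ φ ⊨ B)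
  ⊨-Or φ A B = truth-via (V-Or φ A B) (∨-true _ _)

  ⊨-All : ∀ φ x α A → (φ ⊨ All x α A) ⇔ (∀ d → up φ x α d ⊨ A)
  ⊨-All φ x α A with Vlam φ 0 α To | Vlam φ x α A
  ... | f₁ , e₁ , h₁ | f₂ , e₂ , h₂ = mk⇔ forth back
    where
    forth : φ ⊨ All x α A → ∀ d → up φ x α d ⊨ A
    forth h d = trans (sym (h₂ d)) (trans (cong (λ k → appo α k d) (sym f₁≡f₂)) (trans (h₁ d) (V-To _)))
      where
      f₁≡f₂ : f₁ ≡ f₂
      f₁≡f₂ = DefinedEqual-inj (fn o α) (to (⊨-≐ φ _ _) h) e₁ e₂
    back : (∀ d → up φ x α d ⊨ A) → φ ⊨ All x α A
    back h = from (⊨-≐ φ _ _) (f₁ , e₁ , trans e₂ (cong just (exto α f₂ f₁ λ d →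
               trans (h₂ d) (trans (h d) (sym (trans (h₁ d) (V-To _)))))))

  ⊨-Ex : ∀ φ x α A → (φ ⊨ Ex x α A) ⇔ (¬ (∀ d → ¬ up φ x α d ⊨ A))
  ⊨-Ex φ x α A = mk⇔
    (λ h k → to (⊨-Not φ _) h (from (⊨-All φ x α _) λ d → from (⊨-Not _ A) (k d)))
    (λ h → from (⊨-Not φ _) λ t → h λ d → to (⊨-Not _ A) (to (⊨-All φ x α _) t d))

  occurs≤maxVar : ∀ {y γ α} {A : Tm α} → OccursFree y γ A → y ≤ maxVar A
  occurs≤maxVar here = ≤-refl
  occurs≤maxVar (appl {A = F} {B = B} oc) = ≤-trans (occurs≤maxVar oc) (m≤m⊔n (maxVar F) (maxVar B))
  occurs≤maxVar (appr {A = F} {B = B} oc) = ≤-trans (occurs≤maxVar oc) (m≤n⊔m (maxVar F) (maxVar B))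
  occurs≤maxVar (lamo {y = y} {B = B} _ oc) = ≤-trans (occurs≤maxVar oc) (m≤n⊔m y (maxVar B))

  agree-fresh : ∀ φ {α} (A : Tm α) β d → Agree (up φ (fresh A) β d) φ A
  agree-fresh φ A β d y γ oc = upd-other φ (fresh A) β d y γ λ e →
    1+n≰n (subst (_≤ maxVar A) (proj₁ e) (occurs≤maxVar oc))

  ⊨-Def : ∀ φ {α} (A : Tm α) → (φ ⊨ Def A) ⇔ Defined α (V φ A)
  ⊨-Def φ {α} A = mk⇔ forth back
    where
    y : ℕ
    y = fresh A
    V-A : ∀ d → V (up φ y α d) A ≡ V φ A
    V-A d = coincidence A _ φ (agree-fresh φ A α d)
    V-y : ∀ d → V (up φ y α d) (var y α) ≡ inj K α d
    V-y d = trans (Vvar _ y α) (cong (inj K α) (upd-same φ y α d))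
    forth : φ ⊨ Def A → Defined α (V φ A)
    forth h = Defined-stable α _ λ k → to (⊨-Ex φ y α _) h λ d t →
      let (a , e₁ , e₂) = to (⊨-≐ _ (var y α) A) t in k (a , trans (sym (V-A d)) e₂)
    back : Defined α (V φ A) → φ ⊨ Def A
    back (a , e) = from (⊨-Ex φ y α _) λ k → k a (from (⊨-≐ _ (var y α) A) (a , V-y a , trans (V-A a) e))

  ⊨-≃ : ∀ φ {α} (A B : Tm α) → (φ ⊨ A ≃ B) ⇔ (V φ A ≡ V φ B)
  ⊨-≃ φ {α} A B = mk⇔ forth back
    where
    forth : φ ⊨ A ≃ B → V φ A ≡ V φ B
    forth h = quasi⇒≡ α _ _ λ d → to (⊨-≐ φ A B) (to (⊨-Imp φ _ _) h (from (⊨-Or φ _ _) (def d)))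
      where
      def : Defined α (V φ A) ⊎ Defined α (V φ B) → φ ⊨ Def A ⊎ φ ⊨ Def B
      def (inj₁ p) = inj₁ (from (⊨-Def φ A) p)
      def (inj₂ p) = inj₂ (from (⊨-Def φ B) p)
    back : V φ A ≡ V φ B → φ ⊨ A ≃ B
    back A≡B = from (⊨-Imp φ _ _) λ t → from (⊨-≐ φ A B) (equal (to (⊨-Or φ _ _) t))
      where
      equal : φ ⊨ Def A ⊎ φ ⊨ Def B → DefinedEqual α (V φ A) (V φ B)
      equal (inj₁ t) = let (a , e) = to (⊨-Def φ A) t in a , e , trans (sym A≡B) e
      equal (inj₂ t) = let (a , e) = to (⊨-Def φ B) t in a , trans A≡B e , e

  V-var-untouched : ∀ (φ : Asg I) x α a y γ → ¬ (y ≡ x × γ ≡ α) →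
                    V φ (var y γ) ≡ V (up φ x α a) (var y γ)
  V-var-untouched φ x α a y γ ne =
    trans (Vvar φ y γ) (sym (trans (Vvar _ y γ) (cong (inj K γ) (upd-other φ x α a y γ ne))))

  substitution : ∀ {α β} x (A : Tm α) (B : Tm β) (φ : Asg I) a →
    (OccursFree x α B → V φ A ≡ inj K α a) → FreeFor A x B →
    V φ (S x A B) ≡ V (up φ x α a) B

  substitution-under-λ : ∀ {α β} x (A : Tm α) y γ (B : Tm β) (φ : Asg I) a →
    (OccursFree x α (lam y γ B) → V φ A ≡ inj K α a) → ¬ (y ≡ x × γ ≡ α) →
    FreeFor A x B × (OccursFree x α B → ¬ OccursFree y γ A) →
    V φ (lam y γ (S x A B)) ≡ V (up φ x α a) (lam y γ B)

  substitution {α} x A (var y γ) φ a h _ with y ≟ x | γ ≟T α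
  ... | yes refl | yes refl = trans (h here) (sym (trans (Vvar _ y γ) (cong (inj K γ) (upd-same φ y γ a))))
  ... | yes refl | no γ≠α = V-var-untouched φ x α a y γ λ e → γ≠α (proj₂ e)
  ... | no y≠x | _ = V-var-untouched φ x α a y γ λ e → y≠x (proj₁ e)
  substitution x A (con c) φ a _ _ = trans (Vcon φ c) (sym (Vcon _ c))
  substitution x A (Q γ) φ a _ _ = trans (VQ φ γ) (sym (VQ _ γ))
  substitution x A (iota γ n) φ a _ _ = trans (Vι φ γ n) (sym (Vι _ γ n))
  substitution x A (F · B) φ a h (ffF , ffB) = trans (Vapp φ _ _) (trans (cong₂ (apR _ _)
    (substitution x A F φ a (λ oc → h (appl oc)) ffF) (substitution x A B φ a (λ oc → h (appr oc)) ffB))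
    (sym (Vapp _ F B)))
  substitution {α} x A (lam y γ B) φ a h ff with y ≟ x | γ ≟T α
  ... | yes refl | yes refl =
        coincidence (lam y γ B) φ (up φ y γ a) λ z δ oc → sym (upd-other φ y γ a z δ (bound oc))
    where
    -- x_α is bound here, so it is not among the free variables
    bound : ∀ {z δ} → OccursFree z δ (lam y γ B) → ¬ (z ≡ y × δ ≡ γ)
    bound (lamo ne _) = ≢var-sym ne
  ... | yes refl | no γ≠α = substitution-under-λ x A y γ B φ a h (λ e → γ≠α (proj₂ e)) ff
  ... | no y≠x | _ = substitution-under-λ x A y γ B φ a h (λ e → y≠x (proj₁ e)) ff

  substitution-under-λ {α} x A y γ B φ a h y≠x (ffB , no-capture) =
    lam-cong φ (up φ x α a) y y γ (S x A B) B λ d →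
      trans (substitution x A B (up φ y γ d) a (value-of-A d) ffB)
            (coincidence B _ _ λ z δ _ → upd-comm φ x α a y γ d y≠x z δ)
    where
    -- y_γ is not free in A (else it would be captured), so updating it
    -- keeps the value of A
    value-of-A : ∀ d → OccursFree x α B → V (up φ y γ d) A ≡ inj K α a
    value-of-A d oc = trans (coincidence A _ φ λ z δ oz → upd-other φ y γ d z δ
        λ e → no-capture oc (subst₂ (λ z' δ' → OccursFree z' δ' A) (proj₁ e) (proj₂ e) oz))
      (h (lamo y≠x oc))

  replacement : ∀ {α ok} {A B : Tm α} → (∀ φ → V φ A ≡ V φ B) →
                ∀ {γ} {E E' : Tm γ} → Rep ok A B E E' → ∀ φ → V φ E ≡ V φ E'
  replacement A≡B here φ = A≡B φ
  replacement A≡B (appl {E = E} r) φ =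
    trans (Vapp φ _ _) (trans (cong (λ z → apR _ _ z (V φ E)) (replacement A≡B r φ)) (sym (Vapp φ _ _)))
  replacement A≡B (appr {F = F} r) φ =
    trans (Vapp φ _ _) (trans (cong (apR _ _ (V φ F)) (replacement A≡B r φ)) (sym (Vapp φ _ _)))
  replacement A≡B (lamr {x = x} {β = β} {E = E} {E' = E'} _ r) φ =
    lam-cong φ φ x x β E E' λ d → replacement A≡B r _

  IsSingleton : ∀ {α} → Dfn o α → D α → Set
  IsSingleton {α} p d = ∀ b → (appo α p b ≡ true) ⇔ (b ≡ d)

  abstraction : Asg I → ∀ x α → Tm o → Dfn o α
  abstraction φ x α A = proj₁ (Vlam φ x α A)

  V-The : ∀ φ x α n A → V φ (The x α n A) ≡ applyD α (fn o α) (Jι α n) (abstraction φ x α A)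
  V-The φ x α n A = trans (Vapp φ _ _)
    (trans (cong₂ (apR α (fn o α)) (Vι φ α n) (proj₁ (proj₂ (Vlam φ x α A))))
                      (apply-defined α (fn o α) (Jι α n) _))

  ⊨-The : ∀ φ x α n A d → (V φ (The x α n A) ≡ inj K α d) ⇔ IsSingleton (abstraction φ x α A) d
  ⊨-The φ x .ι ι A d = mk⇔
    (λ e b → let s = to (Jι-sel ι ι _ d) (trans (sym (V-The φ x ι ι A)) e) b in mk⇔ (to s) (from s))
    (λ s → trans (V-The φ x ι ι A) (from (Jι-sel ι ι _ d) λ b → mk⇔ (to (s b)) (from (s b))))
  ⊨-The φ x .(fn _ _) (fn {α} {β}) A d = mk⇔
    (λ e b → let s = to (Jι-sel (fn α β) fn _ d) (trans (sym (V-The φ x (fn α β) fn A)) e) b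
             in mk⇔ (to s) (from s))
    (λ s → trans (V-The φ x (fn α β) fn A) (from (Jι-sel (fn α β) fn _ d) λ b → mk⇔ (to (s b)) (from (s b))))

  ⊨-Ex1 : ∀ φ x α A → (φ ⊨ Ex1 x α A) ⇔ (¬ (∀ d → ¬ IsSingleton (abstraction φ x α A) d))
  ⊨-Ex1 φ x α A = mk⇔
    (λ h k → to (⊨-Ex φ y α _) h λ d t → k d (to (singleton-at d) t))
    (λ h → from (⊨-Ex φ y α _) λ k → h λ d s → k d (from (singleton-at d) s))
    where
    L : Tm (fn o α)
    L = lam x α A
    y : ℕ
    y = fresh L
    p : Dfn o α
    p = abstraction φ x α A
    V-L : ∀ d → V (up φ y α d) L ≡ just p
    V-L d = trans (coincidence L _ φ (agree-fresh φ L α d)) (proj₁ (proj₂ (Vlam φ x α A)))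
    singleton-at : ∀ d → (up φ y α d ⊨ L ≐ (Q α · var y α)) ⇔ IsSingleton p d
    singleton-at d with JQ-id α d
    ... | q , eq , iq = mk⇔ forth back
      where
      V-Qy : V (up φ y α d) (Q α · var y α) ≡ just q
      V-Qy = trans (Vapp _ _ _) (trans (cong₂ (apR (fn o α) α) (VQ _ α)
               (trans (Vvar _ y α) (cong (inj K α) (upd-same φ y α d))))
               (trans (apply-defined (fn o α) α (JQ α) d) eq))
      forth : up φ y α d ⊨ L ≐ (Q α · var y α) → IsSingleton p d
      forth t b = mk⇔ (λ h → sym (to (iq b) (subst (λ z → appo α z b ≡ true) p≡q h)))
                      (λ b≡d → subst (λ z → appo α z b ≡ true) (sym p≡q) (from (iq b) (sym b≡d)))
        where
        p≡q : p ≡ q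
        p≡q = DefinedEqual-inj (fn o α) (to (⊨-≐ _ _ _) t) (V-L d) V-Qy
      back : IsSingleton p d → up φ y α d ⊨ L ≐ (Q α · var y α)
      back s = from (⊨-≐ _ _ _) (p , V-L d , trans V-Qy (cong just (exto α q p λ b → bool-ext
                 (λ h → from (s b) (sym (to (iq b) h))) (λ h → from (iq b) (sym (to (s b) h))))))

  V-var-app : ∀ ψ {α β} k (X : Tm β) b → V ψ X ≡ inj K β b →
              V ψ (var k (fn α β) · X) ≡ applyD α β (ψ k (fn α β)) b
  V-var-app ψ {α} {β} k X b e =
    trans (Vapp ψ _ X) (trans (cong₂ (apR α β) (Vvar ψ k (fn α β)) e) (apply-defined α β _ b))

  -- A1: a predicate on truth values holds everywhere iff it holds at T and F.
  valid-A1 : ∀ φ → φ ⊨ (And (var 3 (fn o o) · To) (var 3 (fn o o) · Fo) ≐ All 0 o (var 3 (fn o o) · var 0 o))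
  valid-A1 φ = from (⊨-≐ₒ φ _ _) (bool-ext forth back)
    where
    g : Dfn o o
    g = φ 3 (fn o o)
    gT gF : Tm o
    gT = var 3 (fn o o) · To
    gF = var 3 (fn o o) · Fo
    at-T : V φ gT ≡ appo o g true
    at-T = V-var-app φ 3 To true (V-To φ)
    at-F : V φ gF ≡ appo o g false
    at-F = V-var-app φ 3 Fo false (V-Fo φ)
    at-var : ∀ d → V (up φ 0 o d) (var 3 (fn o o) · var 0 o) ≡ appo o g d
    at-var d = V-var-app (up φ 0 o d) 3 (var 0 o) d (Vvar _ 0 o)
    forth : φ ⊨ And gT gF → φ ⊨ All 0 o (var 3 (fn o o) · var 0 o)
    forth t = from (⊨-All φ 0 o _) λ where
      true  → trans (at-var true) (trans (sym at-T) (proj₁ (to (⊨-And φ gT gF) t)))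
      false → trans (at-var false) (trans (sym at-F) (proj₂ (to (⊨-And φ gT gF) t)))
    back : φ ⊨ All 0 o (var 3 (fn o o) · var 0 o) → φ ⊨ And gT gF
    back t = from (⊨-And φ gT gF)
      ( trans at-T (trans (sym (at-var true)) (to (⊨-All φ 0 o _) t true))
      , trans at-F (trans (sym (at-var false)) (to (⊨-All φ 0 o _) t false)))

  valid-A2 : ∀ φ α →
             φ ⊨ Imp (var 0 α ≐ var 1 α) ((var 4 (fn o α) · var 0 α) ≐ (var 4 (fn o α) · var 1 α))
  valid-A2 φ α = from (⊨-Imp φ _ _) λ t → from (⊨-≐ₒ φ _ _)
    (trans (V-var-app φ 4 (var 0 α) _ (Vvar φ 0 α))
      (trans (cong (appo α (φ 4 (fn o α))) (x≡y t)) (sym (V-var-app φ 4 (var 1 α) _ (Vvar φ 1 α)))))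
    where
    x≡y : φ ⊨ var 0 α ≐ var 1 α → φ 0 α ≡ φ 1 α
    x≡y t = DefinedEqual-inj α (to (⊨-≐ φ _ _) t) (Vvar φ 0 α) (Vvar φ 1 α)

  valid-A3 : ∀ φ α β → φ ⊨ ((var 2 (fn α β) ≐ var 3 (fn α β))
                           ≐ All 0 β ((var 2 (fn α β) · var 0 β) ≃ (var 3 (fn α β) · var 0 β)))
  valid-A3 φ α β = from (⊨-≐ₒ φ _ _) (bool-ext forth back)
    where
    f g : Dfn α β
    f = φ 2 (fn α β)
    g = φ 3 (fn α β)
    Body : Tm o
    Body = (var 2 (fn α β) · var 0 β) ≃ (var 3 (fn α β) · var 0 β)
    at : ∀ k d → V (up φ 0 β d) (var (suc k) (fn α β) · var 0 β) ≡ applyD α β (φ (suc k) (fn α β)) d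
    at k d = V-var-app (up φ 0 β d) (suc k) (var 0 β) d (trans (Vvar _ 0 β) (cong (inj K β) (upd-same φ 0 β d)))
    forth : φ ⊨ var 2 (fn α β) ≐ var 3 (fn α β) → φ ⊨ All 0 β Body
    forth t = from (⊨-All φ 0 β _) λ d → from (⊨-≃ _ _ _)
      (trans (at 1 d) (trans (cong (λ k → applyD α β k d) f≡g) (sym (at 2 d))))
      where
      f≡g : f ≡ g
      f≡g = DefinedEqual-inj (fn α β) (to (⊨-≐ φ _ _) t) (Vvar φ 2 _) (Vvar φ 3 _)
    back : φ ⊨ All 0 β Body → φ ⊨ var 2 (fn α β) ≐ var 3 (fn α β)
    back t = from (⊨-≐ φ _ _) (f , Vvar φ 2 _ , trans (Vvar φ 3 _) (cong just (sym f≡g)))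
      where
      f≡g : f ≡ g
      f≡g = extensionality α β f g λ d →
        trans (sym (at 1 d)) (trans (to (⊨-≃ _ _ _) (to (⊨-All φ 0 β _) t d)) (at 2 d))

  application-defined : ∀ α β (r : R (fn α β)) (s : R β) → apR α β r s ≢ undef K α →
                        Defined (fn α β) r × Defined β s
  application-defined α β r s k with view (fn α β) r
  ... | undefined _ = ⊥-elim (k refl)
  ... | defined f with view β s
  ...   | undefined n = ⊥-elim (k (apply-undefined α β f n))
  ...   | defined b = (f , refl) , (b , refl)

  some-part-undefined : ∀ φ {α β} (A : Tm (fn α β)) (B : Tm β) → φ ⊨ Or (Undef A) (Undef B) →
                        ¬ (Defined (fn α β) (V φ A) × Defined β (V φ B))
  some-part-undefined φ A B t (dA , dB) =
    [ (λ u → to (⊨-Not φ _) u (from (⊨-Def φ A) dA)) , (λ u → to (⊨-Not φ _) u (from (⊨-Def φ B) dB)) ]′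
      (to (⊨-Or φ _ _) t)

  valid-A9 : ∀ φ {β} (A : Tm (fn o β)) (B : Tm β) → φ ⊨ Imp (Or (Undef A) (Undef B)) (Not (A · B))
  valid-A9 φ {β} A B = from (⊨-Imp φ _ _) λ t → from (⊨-Not φ _) λ tAB →
    some-part-undefined φ A B t (application-defined o β _ _ λ e →
      false≢true (trans (sym e) (trans (sym (Vapp φ A B)) tAB)))

  valid-A10 : ∀ φ {α β} → NotO α → (A : Tm (fn α β)) (B : Tm β) →
              φ ⊨ Imp (Or (Undef A) (Undef B)) (Undef (A · B))
  valid-A10 φ {α} {β} n A B = from (⊨-Imp φ _ _) λ t → from (⊨-Not φ _) λ tAB →
    let (c , e) = to (⊨-Def φ (A · B)) tAB in
    some-part-undefined φ A B t (application-defined α β _ _ λ e' →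
      undef≢inj n (trans (sym e') (trans (sym (Vapp φ A B)) e)))

  valid-A11 : ∀ φ {α} (A B : Tm α) → φ ⊨ Imp (Def A) (Imp (Def B) ((A ≃ B) ≃ (A ≐ B)))
  valid-A11 φ A B = from (⊨-Imp φ _ _) λ tA → from (⊨-Imp φ _ _) λ _ → from (⊨-≃ φ _ _) (bool-ext
    (λ s → let (a , e) = to (⊨-Def φ A) tA in from (⊨-≐ φ A B) (a , e , trans (sym (to (⊨-≃ φ A B) s)) e))
    (λ q → from (⊨-≃ φ A B) (DefinedEqual⇒≡ (to (⊨-≐ φ A B) q))))

  valid-A12 : ∀ φ x α n A → FreeFor (The x α n A) x A →
              φ ⊨ Imp (Ex1 x α A) (And (Def (The x α n A)) (S x (The x α n A) A))
  valid-A12 φ x α n A ff = from (⊨-Imp φ _ _) λ t → true-stable λ ng →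
    to (⊨-Ex1 φ x α A) t λ d s →
      let e = from (⊨-The φ x α n A d) s in
      ng (from (⊨-And φ _ _) (from (⊨-Def φ _) (d , e) ,
        trans (substitution x (The x α n A) A φ d (λ _ → e) ff)
          (trans (sym (proj₂ (proj₂ (Vlam φ x α A)) d)) (from (s d) refl))))

  valid-A13 : ∀ φ x α n A → φ ⊨ Imp (Not (Ex1 x α A)) (Undef (The x α n A))
  valid-A13 φ x α n A = from (⊨-Imp φ _ _) λ t → from (⊨-Not φ _) λ td →
    let (d , e) = to (⊨-Def φ _) td in
    to (⊨-Not φ _) t (from (⊨-Ex1 φ x α A) λ k → k d (to (⊨-The φ x α n A d) e))

  axiom-valid : ∀ {A} → Axiom A → ∀ φ → φ ⊨ A
  axiom-valid A1 φ = valid-A1 φ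
  axiom-valid (A2 α) φ = valid-A2 φ α
  axiom-valid (A3 α β) φ = valid-A3 φ α β
  axiom-valid (A4 x A B ff) φ = from (⊨-Imp φ _ _) λ t → let (a , e) = to (⊨-Def φ A) t in
    from (⊨-≃ φ _ _) (trans (β-value φ x B A a e) (sym (substitution x A B φ a (λ _ → e) ff)))
  axiom-valid (A5 x α) φ = from (⊨-Def φ _) (φ x α , Vvar φ x α)
  axiom-valid (A6c c) φ = from (⊨-Def φ _) (J c , Vcon φ c)
  axiom-valid (A6Q α) φ = from (⊨-Def φ _) (JQ α , VQ φ α)
  axiom-valid (A6ι α n) φ = from (⊨-Def φ _) (Jι α n , Vι φ α n)
  axiom-valid (A7 x β B) φ = from (⊨-Def φ _) (proj₁ (Vlam φ x β B) , proj₁ (proj₂ (Vlam φ x β B)))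
  axiom-valid (A8 A B) φ = from (⊨-Def φ _) (V φ (A · B) , refl)
  axiom-valid (A9 A B) φ = valid-A9 φ A B
  axiom-valid (A10 n A B) φ = valid-A10 φ n A B
  axiom-valid (A11 A B) φ = valid-A11 φ A B
  axiom-valid (A12 x α n A ff) φ = valid-A12 φ x α n A ff
  axiom-valid (A13 x α n A) φ = valid-A13 φ x α n A

  Valid : Tm o → Set
  Valid A = ∀ φ → φ ⊨ A

  -- R1 preserves validity.
  R1-valid : ∀ {α ok} {A B : Tm α} {E E' : Tm o} → Valid (A ≃ B) → Valid E → Rep ok A B E E' → Valid E'
  R1-valid A≃B E r φ = subst (_≡ true) (replacement (λ ψ → to (⊨-≃ ψ _ _) (A≃B ψ)) r φ) (E φ)

  R2-valid : ∀ {A B} → Valid A → Valid (Imp A B) → Valid B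
  R2-valid A A⊃B φ = to (⊨-Imp φ _ _) (A⊃B φ) (A φ)

  theorem-valid : ∀ {A} → Thm A → Valid A
  theorem-valid (ax a) = axiom-valid a
  theorem-valid (r1 p q r) = R1-valid (theorem-valid p) (theorem-valid q) r
  theorem-valid (r2 p q) = R2-valid (theorem-valid p) (theorem-valid q)

  provable-valid : ∀ {H} → ModelFor M H → ∀ {A} → Proves H A → Valid A
  provable-valid M⊨H (thm t) = theorem-valid t
  provable-valid M⊨H (hyp {A} h) = M⊨H A h
  provable-valid M⊨H (r1 p q r) = R1-valid (provable-valid M⊨H p) (provable-valid M⊨H q) r
  provable-valid M⊨H (r2 p q) = R2-valid (provable-valid M⊨H p) (provable-valid M⊨H q)

  -- F_o is not valid: it is false under any assignment, and the nonempty
  -- domains provide one.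
  Fo-not-valid : ¬ Valid Fo
  Fo-not-valid valid = false≢true (trans (sym (V-Fo φ₀)) (valid φ₀))
    where
    φ₀ : Asg I
    φ₀ _ ι = ιne
    φ₀ _ o = true
    φ₀ _ (fn α β) = fnne α β

mainTheorem4 : (C : Ty → Set) (H : Lang.Tm C o → Set) →
               Lang.HasGeneralModel C H → Lang.Consistent C H
mainTheorem4 C H (M , M⊨H) ⊢F = Fo-not-valid (provable-valid M⊨H ⊢F)
  where open Soundness C M
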